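{- Let $n>1$ be an integer and let $M_{2n}$ be the Möbius ladder on $2n$ vertices. Then \[ \det A(M_{2n})= \begin{cases} -3 & \text{if } n\equiv \pm 2 \pmod{6};\\ -9 & \text{if } n\equiv \pm 1 \pmod{6};\\ 0 & \text{otherwise}. \end{cases} \]
   Context: For a graph $G$, $A(G)$ denotes its adjacency matrix. The Möbius ladder $M_{2n}$ is the graph on vertices $v_1,\dots,v_{2n}$ whose edge set is the union of the edge set of the cycle $v_1v_2\cdots v_{2n}v_1$ and the set $\{v_iv_{n+i}: i=1,\dots,n\}$. -}

module Defs where

open import Data.Nat as ℕ using (ℕ; zero; suc; _%_)
open import Data.Nat.Properties using () renaming (_≟_ to _≟ℕ_)
open import Data.Fin using (Fin; toℕ; punchIn)
open import Data.Integer using (ℤ; +_; -_; _*_; _+_)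
open import Data.Bool using (Bool; true; false; _∨_; if_then_else_)
open import Relation.Nullary.Decidable using (⌊_⌋)

Matrix : ℕ → Set
Matrix n = Fin n → Fin n → ℤ

sumFin : ∀ {n} → (Fin n → ℤ) → ℤ
sumFin {zero}  f = + 0
sumFin {suc n} f = f Data.Fin.zero + sumFin (λ i → f (Data.Fin.suc i))

sign : ℕ → ℤ
sign zero = + 1
sign (suc k) = - sign k

minor : ∀ {n} → Matrix (suc n) → Fin (suc n) → Matrix n
minor M j i k = M (Data.Fin.suc i) (punchIn j k)

det : ∀ n → Matrix n → ℤ
det zero    M = + 1
det (suc n) M = sumFin (λ j → sign (toℕ j) * (M Data.Fin.zero j * det n (minor M j)))

-- Adjacency of the Möbius ladder M_{2n}: vertex v_{i+1} is represented by i : Fin (2n).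
-- v_i ~ v_j iff j ≡ i+1, or i ≡ j+1 (cycle edges), or j ≡ i+n (rung edges), modulo 2n.
mobiusAdj : (n : ℕ) → Fin (2 ℕ.* n) → Fin (2 ℕ.* n) → Bool
mobiusAdj n i j =
  ⌊ (suc (toℕ i) % suc m) ≟ℕ toℕ j ⌋ ∨
  (⌊ (suc (toℕ j) % suc m) ≟ℕ toℕ i ⌋ ∨
   ⌊ ((toℕ i ℕ.+ n) % suc m) ≟ℕ toℕ j ⌋)
  where
  m : ℕ
  m = ℕ.pred (2 ℕ.* n)
  -- note: when 2n = 0 there are no vertices, so the choice of modulus is irrelevant

A-Mobius : (n : ℕ) → Matrix (2 ℕ.* n)
A-Mobius n i j = if mobiusAdj n i j then + 1 else + 0

-- Number v_1 … v_{2n} as 0 … 2n − 1. The rungs match the halves 0 … n − 1 and n … 2n − 1, so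
-- A(M_{2n}) = [[P, R], [R, P]], where P is the adjacency matrix of a path and R is the identity plus the two cycle
-- edges v_n v_{n+1} and v_{2n} v_1 joining the halves. Adding the lower rows to the upper ones and then subtracting
-- the left columns from the right ones makes the matrix block lower triangular, so det A = det(P + R) det(P − R).
-- Both factors are cyclic band matrices with 1 beside the diagonal and s = ±1 on the diagonal and in the corners.
-- Clearing the first row with the second column and expanding lowers the size by one, flips the sign, and acts on
-- the top entries of the first and last columns by (p, q) ↦ (q − s p, −p), a map of order 3 or 6. Hence det A
-- depends only on n mod 6, and the six values are products of 2 × 2 determinants.

module Submission where

open import Defs
open import Function using (_∘_; const)
open import Data.Bool using (Bool; true; false; if_then_else_; _∧_; _∨_; T)
open import Data.Bool.Properties using (∧-zeroʳ; ∧-identityʳ)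
open import Data.Empty using (⊥-elim)
open import Data.Product using (∃; _,_; _×_; proj₁; proj₂)
open import Data.Sum using (_⊎_; inj₁; inj₂; [_,_]′)
open import Data.Nat as ℕ using (ℕ; zero; suc; _≡ᵇ_; _%_; _≤_; _<_; z≤n; s≤s)
import Data.Nat.Properties as ℕ
open import Data.Nat.DivMod using (m<n⇒m%n≡m; [m+n]%n≡m%n; n%n≡0)
open import Data.Fin as Fin using (Fin; zero; suc; toℕ; punchIn; punchOut; inject₁; _↑ˡ_; _↑ʳ_; splitAt)
open import Data.Fin.Properties
  using ( suc-injective; toℕ-injective; toℕ-inject₁; toℕ-↑ˡ; toℕ-↑ʳ; toℕ-cast; toℕ<n; toℕ-fromℕ<
        ; punchInᵢ≢i; punchIn-injective; punchIn-punchOut; punchOut-punchIn; punchOut-cong; splitAt-↑ˡ; splitAt-↑ʳ)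
open import Data.Integer as ℤ using (ℤ; +_; -[1+_]; -_; _+_; _*_; -1ℤ)
open import Data.Integer.Properties as ℤ
  using ( +-*-semiring; +-commutativeSemigroup; +-identityʳ; *-identityˡ; *-zeroʳ
        ; -1*i≡-i; neg-involutive; neg-distribˡ-*; neg-distribʳ-*)
open import Data.Integer.Tactic.RingSolver using (solve-∀)
open import Algebra.Properties.Semiring.Sum +-*-semiring
  using (sum; sum-cong-≗; ∑-distrib-+; *-distribˡ-sum; *-distribʳ-sum; sum-remove; sum-replicate-zero; ∑-comm)
open import Algebra.Properties.CommutativeSemigroup +-commutativeSemigroup using (x∙yz≈y∙xz)
open import Data.Vec.Functional using (updateAt)
open import Data.Vec.Functional.Properties using (updateAt-updates; updateAt-minimal)
open import Relation.Nullary using (yes; no)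
open import Relation.Nullary.Decidable using (isYes≗does)
open import Relation.Binary.Definitions using (tri<; tri≈; tri>)
open import Relation.Binary.PropositionalEquality

open ≡-Reasoning

-- Sums over Fin

sumFin≡sum : ∀ {n} (f : Fin n → ℤ) → sumFin f ≡ sum f
sumFin≡sum {zero}  f = refl
sumFin≡sum {suc n} f = cong (_+_ (f zero)) (sumFin≡sum (f ∘ suc))

sum-zero : ∀ {n} {f : Fin n → ℤ} → (∀ i → f i ≡ + 0) → sum f ≡ + 0
sum-zero {n} f≗0 = trans (sum-cong-≗ f≗0) (sum-replicate-zero n)

sum-neg : ∀ {n} (f : Fin n → ℤ) → sum (λ i → - f i) ≡ - sum f
sum-neg f = begin
  sum (λ i → - f i)      ≡⟨ sum-cong-≗ (λ i → sym (-1*i≡-i (f i))) ⟩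
  sum (λ i → -1ℤ * f i)  ≡⟨ *-distribˡ-sum -1ℤ f ⟨
  -1ℤ * sum f            ≡⟨ -1*i≡-i (sum f) ⟩
  - sum f                ∎

sum-single : ∀ {n} (f : Fin (suc n) → ℤ) (c : Fin (suc n)) → (∀ j → j ≢ c → f j ≡ + 0) → sum f ≡ f c
sum-single f c others≡0 = begin
  sum f                          ≡⟨ sum-remove {i = c} f ⟩
  f c + sum (f ∘ punchIn c)      ≡⟨ cong (_+_ (f c)) (sum-zero (λ k → others≡0 _ (punchInᵢ≢i c k))) ⟩
  f c + + 0                      ≡⟨ +-identityʳ (f c) ⟩
  f c                            ∎

sum-↑ : ∀ k {m} (f : Fin (k ℕ.+ m) → ℤ) → sum f ≡ sum (λ i → f (i ↑ˡ m)) + sum (λ j → f (k ↑ʳ j))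
sum-↑ zero    f = sym (ℤ.+-identityˡ (sum f))
sum-↑ (suc k) f = trans (cong (_+_ (f zero)) (sum-↑ k (f ∘ suc))) (sym (ℤ.+-assoc (f zero) _ _))

swap : ∀ {n} → Fin n → Fin (suc n) → Fin (suc n)
swap zero    zero          = suc zero
swap zero    (suc zero)    = zero
swap zero    (suc (suc k)) = suc (suc k)
swap (suc e) zero          = zero
swap (suc e) (suc k)       = suc (swap e k)

swap-inject₁ : ∀ {n} (e : Fin n) → swap e (inject₁ e) ≡ suc e
swap-inject₁ zero    = refl
swap-inject₁ (suc e) = cong suc (swap-inject₁ e)

swap-suc : ∀ {n} (e : Fin n) → swap e (suc e) ≡ inject₁ e
swap-suc zero    = refl
swap-suc (suc e) = cong suc (swap-suc e)

swap-other : ∀ {n} (e : Fin n) {k} → k ≢ inject₁ e → k ≢ suc e → swap e k ≡ k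
swap-other zero    {zero}          k≢e _     = ⊥-elim (k≢e refl)
swap-other zero    {suc zero}      _   k≢e+1 = ⊥-elim (k≢e+1 refl)
swap-other zero    {suc (suc k)}   _   _     = refl
swap-other (suc e) {zero}          _   _     = refl
swap-other (suc e) {suc k}         k≢e k≢e+1 = cong suc (swap-other e (k≢e ∘ cong suc) (k≢e+1 ∘ cong suc))

swap-involutive : ∀ {n} (e : Fin n) k → swap e (swap e k) ≡ k
swap-involutive zero    zero          = refl
swap-involutive zero    (suc zero)    = refl
swap-involutive zero    (suc (suc k)) = refl
swap-involutive (suc e) zero          = refl
swap-involutive (suc e) (suc k)       = cong suc (swap-involutive e k)

sum-swap : ∀ {n} (e : Fin n) (f : Fin (suc n) → ℤ) → sum (f ∘ swap e) ≡ sum f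
sum-swap zero    f = x∙yz≈y∙xz (f (suc zero)) (f zero) _
sum-swap (suc e) f = cong (_+_ (f zero)) (sum-swap e (f ∘ suc))

swap-punchIn-inject₁ : ∀ {n} (e : Fin n) k → swap e (punchIn (inject₁ e) k) ≡ punchIn (suc e) k
swap-punchIn-inject₁ zero    zero    = refl
swap-punchIn-inject₁ zero    (suc k) = refl
swap-punchIn-inject₁ (suc e) zero    = refl
swap-punchIn-inject₁ (suc e) (suc k) = cong suc (swap-punchIn-inject₁ e k)

swap-punchIn-suc : ∀ {n} (e : Fin n) k → swap e (punchIn (suc e) k) ≡ punchIn (inject₁ e) k
swap-punchIn-suc e k = begin
  swap e (punchIn (suc e) k)                      ≡⟨ cong (swap e) (swap-punchIn-inject₁ e k) ⟨
  swap e (swap e (punchIn (inject₁ e) k))         ≡⟨ swap-involutive e _ ⟩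
  punchIn (inject₁ e) k                           ∎

swap-punchIn : ∀ {m} (e : Fin (suc m)) (j : Fin (suc (suc m))) → j ≢ inject₁ e → j ≢ suc e →
               ∃ λ e′ → ∀ k → swap e (punchIn j k) ≡ punchIn j (swap e′ k)
swap-punchIn zero    zero                j≢e _     = ⊥-elim (j≢e refl)
swap-punchIn zero    (suc zero)          _   j≢e+1 = ⊥-elim (j≢e+1 refl)
swap-punchIn {suc m} zero (suc (suc j))  _   _     = zero , λ
  { zero → refl ; (suc zero) → refl ; (suc (suc k)) → refl }
swap-punchIn (suc e) zero                _   _     = e , λ k → refl
swap-punchIn {suc m} (suc e) (suc j)     j≢e j≢e+1 with swap-punchIn e j (j≢e ∘ cong suc) (j≢e+1 ∘ cong suc)
... | e′ , commutes = suc e′ , λ { zero → refl ; (suc k) → cong suc (commutes k) }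

-- Laplace expansion: linearity and alternation

expansionTerm : ∀ {n} → Matrix (suc n) → Fin (suc n) → ℤ
expansionTerm {n} M j = sign (toℕ j) * (M zero j * det n (minor M j))

det-expand : ∀ {n} (M : Matrix (suc n)) → det (suc n) M ≡ sum (expansionTerm M)
det-expand M = sumFin≡sum (expansionTerm M)

det-cong : ∀ {n} {M N : Matrix n} → (∀ i j → M i j ≡ N i j) → det n M ≡ det n N
det-cong {zero}              _   = refl
det-cong {suc n} {M} {N} M≗N = begin
  det (suc n) M          ≡⟨ det-expand M ⟩
  sum (expansionTerm M)  ≡⟨ sum-cong-≗ term ⟩
  sum (expansionTerm N)  ≡⟨ det-expand N ⟨
  det (suc n) N          ∎
  where
  term : ∀ j → expansionTerm M j ≡ expansionTerm N j
  term j = cong₂ (λ a d → sign (toℕ j) * (a * d)) (M≗N zero j) (det-cong (λ i k → M≗N (suc i) (punchIn j k)))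

private
  flip-sign : ∀ s y → s * y ≡ - (- s * y)
  flip-sign s y = trans (sym (neg-involutive (s * y))) (cong -_ (neg-distribˡ-* s y))

  negate-minor : ∀ s a d → s * (a * - d) ≡ - (s * (a * d))
  negate-minor s a d = trans (cong (s *_) (sym (neg-distribʳ-* a d))) (sym (neg-distribʳ-* s (a * d)))

  linear-at-entry : ∀ s a x b d → s * ((a + x * b) * d) ≡ s * (a * d) + x * (s * (b * d))
  linear-at-entry = solve-∀

  linear-at-minor : ∀ s a x d e → s * (a * (d + x * e)) ≡ s * (a * d) + x * (s * (a * e))
  linear-at-minor = solve-∀

  module _ {n} {M N P : Matrix (suc n)} (x : ℤ) (j : Fin (suc n)) where

    term-linear-entry : M zero j ≡ N zero j + x * P zero j →
                        det n (minor M j) ≡ det n (minor N j) → det n (minor M j) ≡ det n (minor P j) →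
                        expansionTerm M j ≡ expansionTerm N j + x * expansionTerm P j
    term-linear-entry Mj dN dP = begin
      s * (M zero j * d)                             ≡⟨ cong (λ a → s * (a * d)) Mj ⟩
      s * ((N zero j + x * P zero j) * d)            ≡⟨ linear-at-entry s (N zero j) x (P zero j) d ⟩
      s * (N zero j * d) + x * (s * (P zero j * d))  ≡⟨ cong₂ (λ d₁ d₂ → s * (N zero j * d₁) + x * (s * (P zero j * d₂))) dN dP ⟩
      expansionTerm N j + x * expansionTerm P j      ∎
      where
      s = sign (toℕ j)
      d = det n (minor M j)

    term-linear-minor : M zero j ≡ N zero j → M zero j ≡ P zero j →
                        det n (minor M j) ≡ det n (minor N j) + x * det n (minor P j) →
                        expansionTerm M j ≡ expansionTerm N j + x * expansionTerm P j
    term-linear-minor MN MP d = begin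
      s * (a * det n (minor M j))                         ≡⟨ cong (λ d′ → s * (a * d′)) d ⟩
      s * (a * (dN + x * dP))                             ≡⟨ linear-at-minor s a x dN dP ⟩
      s * (a * dN) + x * (s * (a * dP))                   ≡⟨ cong₂ (λ b c → s * (b * dN) + x * (s * (c * dP))) MN MP ⟩
      expansionTerm N j + x * expansionTerm P j           ∎
      where
      s = sign (toℕ j)
      a = M zero j
      dN = det n (minor N j)
      dP = det n (minor P j)

det-linear-by-terms : ∀ {n} (x : ℤ) {M N P : Matrix (suc n)} →
                      (∀ j → expansionTerm M j ≡ expansionTerm N j + x * expansionTerm P j) →
                      det (suc n) M ≡ det (suc n) N + x * det (suc n) P
det-linear-by-terms {n} x {M} {N} {P} termwise = begin
  det (suc n) M                      ≡⟨ det-expand M ⟩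
  sum (expansionTerm M)              ≡⟨ sum-cong-≗ termwise ⟩
  sum (λ j → tN j + x * tP j)        ≡⟨ ∑-distrib-+ tN (λ j → x * tP j) ⟩
  sum tN + sum (λ j → x * tP j)      ≡⟨ cong₂ _+_ (det-expand N) (*-distribˡ-sum x tP) ⟨
  det (suc n) N + x * sum tP         ≡⟨ cong (λ d → det (suc n) N + x * d) (det-expand P) ⟨
  det (suc n) N + x * det (suc n) P  ∎
  where
  tN = expansionTerm N
  tP = expansionTerm P

det-linear-column : ∀ {n} (c : Fin n) (x : ℤ) {M N P : Matrix n} →
                    (∀ i k → k ≢ c → M i k ≡ N i k) → (∀ i k → k ≢ c → M i k ≡ P i k) →
                    (∀ i → M i c ≡ N i c + x * P i c) → det n M ≡ det n N + x * det n P
det-linear-column {suc n} c x {M} {N} {P} M≗N M≗P Mc = det-linear-by-terms x {M} {N} {P} term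
  where
  term : ∀ j → expansionTerm M j ≡ expansionTerm N j + x * expansionTerm P j
  term j with j Fin.≟ c
  ... | yes refl = term-linear-entry {M = M} {N} {P} x j (Mc zero)
                     (det-cong (λ i k → M≗N (suc i) (punchIn j k) (punchInᵢ≢i j k)))
                     (det-cong (λ i k → M≗P (suc i) (punchIn j k) (punchInᵢ≢i j k)))
  ... | no j≢c = term-linear-minor {M = M} {N} {P} x j (M≗N zero j j≢c) (M≗P zero j j≢c)
                   (det-linear-column c′ x {minor M j} {minor N j} {minor P j} (λ i k k≢c′ → M≗N (suc i) (punchIn j k) (avoids k≢c′))
                                           (λ i k k≢c′ → M≗P (suc i) (punchIn j k) (avoids k≢c′))
                                           (λ i → subst (λ c″ → M (suc i) c″ ≡ N (suc i) c″ + x * P (suc i) c″)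
                                                        (sym (punchIn-punchOut j≢c)) (Mc (suc i))))
    where
    c′ = punchOut j≢c
    avoids : ∀ {k} → k ≢ c′ → punchIn j k ≢ c
    avoids k≢c′ eq = k≢c′ (punchIn-injective j _ c′ (trans eq (sym (punchIn-punchOut j≢c))))

det-linear-row : ∀ {n} (r : Fin n) (x : ℤ) {M N P : Matrix n} →
                 (∀ i k → i ≢ r → M i k ≡ N i k) → (∀ i k → i ≢ r → M i k ≡ P i k) →
                 (∀ k → M r k ≡ N r k + x * P r k) → det n M ≡ det n N + x * det n P
det-linear-row {suc n} zero x {M} {N} {P} M≗N M≗P Mr = det-linear-by-terms x {M} {N} {P} λ j →
  term-linear-entry {M = M} {N} {P} x j (Mr j) (det-cong (λ i k → M≗N (suc i) _ (λ ()))) (det-cong (λ i k → M≗P (suc i) _ (λ ())))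
det-linear-row {suc n} (suc r) x {M} {N} {P} M≗N M≗P Mr = det-linear-by-terms x {M} {N} {P} λ j →
  term-linear-minor {M = M} {N} {P} x j (M≗N zero j (λ ())) (M≗P zero j (λ ()))
    (det-linear-row r x {minor M j} {minor N j} {minor P j} (λ i k i≢r → M≗N (suc i) _ (i≢r ∘ suc-injective))
                        (λ i k i≢r → M≗P (suc i) _ (i≢r ∘ suc-injective))
                        (λ k → Mr (punchIn j k)))

det-swap-columns : ∀ {n} (e : Fin n) (M : Matrix (suc n)) → det (suc n) (λ i k → M i (swap e k)) ≡ - det (suc n) M
det-swap-columns {suc m} e M = begin
  det (suc (suc m)) M′                          ≡⟨ det-expand M′ ⟩
  sum (expansionTerm M′)                        ≡⟨ sum-cong-≗ term ⟩
  sum (λ j → - expansionTerm M (swap e j))      ≡⟨ sum-neg (expansionTerm M ∘ swap e) ⟩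
  - sum (expansionTerm M ∘ swap e)              ≡⟨ cong -_ (sum-swap e (expansionTerm M)) ⟩
  - sum (expansionTerm M)                       ≡⟨ cong -_ (det-expand M) ⟨
  - det (suc (suc m)) M                         ∎
  where
  M′ : Matrix (suc (suc m))
  M′ i k = M i (swap e k)
  term : ∀ j → expansionTerm M′ j ≡ - expansionTerm M (swap e j)
  term j with j Fin.≟ inject₁ e | j Fin.≟ suc e
  ... | yes refl | _ = begin
    sign (toℕ (inject₁ e)) * (M zero (swap e (inject₁ e)) * det (suc m) (minor M′ (inject₁ e)))
      ≡⟨ cong₂ (λ s a → s * (a * det (suc m) (minor M′ (inject₁ e)))) (cong sign (toℕ-inject₁ e)) (cong (M zero) (swap-inject₁ e)) ⟩
    sign (toℕ e) * (M zero (suc e) * det (suc m) (minor M′ (inject₁ e)))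
      ≡⟨ cong (λ d → sign (toℕ e) * (M zero (suc e) * d)) (det-cong (λ i k → cong (M (suc i)) (swap-punchIn-inject₁ e k))) ⟩
    sign (toℕ e) * (M zero (suc e) * det (suc m) (minor M (suc e)))
      ≡⟨ flip-sign (sign (toℕ e)) (M zero (suc e) * det (suc m) (minor M (suc e))) ⟩
    - expansionTerm M (suc e)
      ≡⟨ cong (λ j → - expansionTerm M j) (swap-inject₁ e) ⟨
    - expansionTerm M (swap e (inject₁ e)) ∎
  ... | no _ | yes refl = begin
    - sign (toℕ e) * (M zero (swap e (suc e)) * det (suc m) (minor M′ (suc e)))
      ≡⟨ cong₂ (λ a d → - sign (toℕ e) * (a * d)) (cong (M zero) (swap-suc e)) (det-cong (λ i k → cong (M (suc i)) (swap-punchIn-suc e k))) ⟩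
    - sign (toℕ e) * (M zero (inject₁ e) * det (suc m) (minor M (inject₁ e)))
      ≡⟨ neg-distribˡ-* (sign (toℕ e)) (M zero (inject₁ e) * det (suc m) (minor M (inject₁ e))) ⟨
    - (sign (toℕ e) * (M zero (inject₁ e) * det (suc m) (minor M (inject₁ e))))
      ≡⟨ cong (λ s → - (s * (M zero (inject₁ e) * det (suc m) (minor M (inject₁ e))))) (cong sign (toℕ-inject₁ e)) ⟨
    - expansionTerm M (inject₁ e)
      ≡⟨ cong (λ j → - expansionTerm M j) (swap-suc e) ⟨
    - expansionTerm M (swap e (suc e)) ∎
  ... | no j≢e | no j≢e+1 with swap-punchIn e j j≢e j≢e+1
  ...   | e′ , commutes = begin
    sign (toℕ j) * (M zero (swap e j) * det (suc m) (minor M′ j))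
      ≡⟨ cong₂ (λ a d → sign (toℕ j) * (a * d)) (cong (M zero) (swap-other e j≢e j≢e+1))
           (trans (det-cong (λ i k → cong (M (suc i)) (commutes k))) (det-swap-columns e′ (minor M j))) ⟩
    sign (toℕ j) * (M zero j * - det (suc m) (minor M j))
      ≡⟨ negate-minor (sign (toℕ j)) (M zero j) (det (suc m) (minor M j)) ⟩
    - expansionTerm M j
      ≡⟨ cong (λ j → - expansionTerm M j) (swap-other e j≢e j≢e+1) ⟨
    - expansionTerm M (swap e j) ∎

-- Sign of the term of the expansion along the first two rows that uses column a in row 0 and column b in row 1.
pairSign : ∀ {m} {a b : Fin (suc (suc m))} → a ≢ b → ℤ
pairSign {a = a} a≢b = sign (toℕ a) * sign (toℕ (punchOut a≢b))

pairSign-antisym : ∀ {m} {a b : Fin (suc (suc m))} (a≢b : a ≢ b) (b≢a : b ≢ a) → pairSign a≢b ≡ - pairSign b≢a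
pairSign-antisym {_}     {zero}      {zero}      a≢b _   = ⊥-elim (a≢b refl)
pairSign-antisym {_}     {zero}      {suc b}     _   _   = units (sign (toℕ b))
  where
  units : ∀ s → + 1 * s ≡ - (- s * + 1)
  units = solve-∀
pairSign-antisym {_}     {suc a}     {zero}      _   _   = units (sign (toℕ a))
  where
  units : ∀ s → - s * + 1 ≡ - (+ 1 * s)
  units = solve-∀
pairSign-antisym {zero}  {suc zero}  {suc zero}  a≢b _   = ⊥-elim (a≢b refl)
pairSign-antisym {suc m} {suc a}     {suc b}     a≢b b≢a =
  trans (negate-both (sign (toℕ a)) (sign (toℕ (punchOut a≢b′))))
        (trans (pairSign-antisym a≢b′ b≢a′) (cong -_ (sym (negate-both (sign (toℕ b)) (sign (toℕ (punchOut b≢a′)))))))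
  where
  negate-both : ∀ s t → - s * - t ≡ s * t
  negate-both = solve-∀
  a≢b′ : a ≢ b
  a≢b′ = a≢b ∘ cong suc
  b≢a′ : b ≢ a
  b≢a′ = b≢a ∘ cong suc

punchIn-punchOut-comm : ∀ {m} {a b : Fin (suc (suc m))} (a≢b : a ≢ b) (b≢a : b ≢ a) (l : Fin m) →
                        punchIn a (punchIn (punchOut a≢b) l) ≡ punchIn b (punchIn (punchOut b≢a) l)
punchIn-punchOut-comm {_}     {zero}  {zero}  a≢b _   l       = ⊥-elim (a≢b refl)
punchIn-punchOut-comm {_}     {zero}  {suc b} _   _   l       = refl
punchIn-punchOut-comm {_}     {suc a} {zero}  _   _   l       = refl
punchIn-punchOut-comm {suc m} {suc a} {suc b} _   _   zero    = refl
punchIn-punchOut-comm {suc m} {suc a} {suc b} a≢b b≢a (suc l) =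
  cong suc (punchIn-punchOut-comm (a≢b ∘ cong suc) (b≢a ∘ cong suc) l)

pairTerm : ∀ {m} → Matrix (suc (suc m)) → Fin (suc (suc m)) → Fin (suc (suc m)) → ℤ
pairTerm {m} M a b with a Fin.≟ b
... | yes _   = + 0
... | no a≢b  = pairSign a≢b * (M zero a * (M (suc zero) b * det m (λ i l → M (suc (suc i)) (punchIn a (punchIn (punchOut a≢b) l)))))

pairTerm-diagonal : ∀ {m} (M : Matrix (suc (suc m))) a → pairTerm M a a ≡ + 0
pairTerm-diagonal M a with a Fin.≟ a
... | yes _  = refl
... | no a≢a = ⊥-elim (a≢a refl)

pairTerm-punchIn : ∀ {m} (M : Matrix (suc (suc m))) a k →
                   pairTerm M a (punchIn a k) ≡ sign (toℕ a) * (M zero a * expansionTerm (minor M a) k)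
pairTerm-punchIn {m} M a k with a Fin.≟ punchIn a k
... | yes a≡b = ⊥-elim (punchInᵢ≢i a k (sym a≡b))
... | no a≢b  = begin
  (sign (toℕ a) * sign (toℕ (punchOut a≢b))) * (x * (y * det m (λ i l → M (suc (suc i)) (punchIn a (punchIn (punchOut a≢b) l)))))
    ≡⟨ cong (λ k′ → (sign (toℕ a) * sign (toℕ k′)) * (x * (y * det m (λ i l → M (suc (suc i)) (punchIn a (punchIn k′ l))))))
            (trans (punchOut-cong a refl) (punchOut-punchIn a)) ⟩
  (sign (toℕ a) * sign (toℕ k)) * (x * (y * d))
    ≡⟨ reorder (sign (toℕ a)) (sign (toℕ k)) x y d ⟩
  sign (toℕ a) * (x * (sign (toℕ k) * (y * d)))  ∎
  where
  x = M zero a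
  y = M (suc zero) (punchIn a k)
  d = det m (minor (minor M a) k)
  reorder : ∀ s t x y d → (s * t) * (x * (y * d)) ≡ s * (x * (t * (y * d)))
  reorder = solve-∀

det-expand-pairs : ∀ {m} (M : Matrix (suc (suc m))) → det (suc (suc m)) M ≡ sum (λ a → sum (pairTerm M a))
det-expand-pairs {m} M = trans (det-expand M) (sum-cong-≗ row)
  where
  row : ∀ a → expansionTerm M a ≡ sum (pairTerm M a)
  row a = begin
    s * (x * det (suc m) (minor M a))                  ≡⟨ cong (λ d → s * (x * d)) (det-expand (minor M a)) ⟩
    s * (x * sum t)                                    ≡⟨ cong (s *_) (*-distribˡ-sum x t) ⟩
    s * sum (λ k → x * t k)                            ≡⟨ *-distribˡ-sum s (λ k → x * t k) ⟩
    sum (λ k → s * (x * t k))                          ≡⟨ sum-cong-≗ (λ k → pairTerm-punchIn M a k) ⟨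
    sum (pairTerm M a ∘ punchIn a)                     ≡⟨ ℤ.+-identityˡ _ ⟨
    + 0 + sum (pairTerm M a ∘ punchIn a)               ≡⟨ cong (_+ sum (pairTerm M a ∘ punchIn a)) (pairTerm-diagonal M a) ⟨
    pairTerm M a a + sum (pairTerm M a ∘ punchIn a)    ≡⟨ sum-remove {i = a} (pairTerm M a) ⟨
    sum (pairTerm M a)                                 ∎
    where
    s = sign (toℕ a)
    x = M zero a
    t = expansionTerm (minor M a)

pairTerm-swap : ∀ {m} (M : Matrix (suc (suc m))) a b → pairTerm (M ∘ swap zero) a b ≡ - pairTerm M b a
pairTerm-swap {m} M a b with a Fin.≟ b | b Fin.≟ a
... | yes _   | yes _   = refl
... | yes a≡b | no b≢a  = ⊥-elim (b≢a (sym a≡b))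
... | no a≢b  | yes b≡a = ⊥-elim (a≢b (sym b≡a))
... | no a≢b  | no b≢a  = begin
  pairSign a≢b * (M (suc zero) a * (M zero b * D a≢b))
    ≡⟨ cong₂ (λ σ d → σ * (M (suc zero) a * (M zero b * d))) (pairSign-antisym a≢b b≢a)
             (det-cong (λ i l → cong (M (suc (suc i))) (punchIn-punchOut-comm a≢b b≢a l))) ⟩
  - pairSign b≢a * (M (suc zero) a * (M zero b * D b≢a))
    ≡⟨ reorder (pairSign b≢a) (M (suc zero) a) (M zero b) (D b≢a) ⟩
  - (pairSign b≢a * (M zero b * (M (suc zero) a * D b≢a)))  ∎
  where
  D : ∀ {c d} → c ≢ d → ℤ
  D {c} c≢d = det m (λ i l → M (suc (suc i)) (punchIn c (punchIn (punchOut c≢d) l)))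
  reorder : ∀ σ x y d → - σ * (x * (y * d)) ≡ - (σ * (y * (x * d)))
  reorder = solve-∀

-- Swapping rows 0 and 1 exchanges the columns a and b in the expansion along both rows, and pairSign is antisymmetric.
det-swap-rows : ∀ {n} (e : Fin n) (M : Matrix (suc n)) → det (suc n) (M ∘ swap e) ≡ - det (suc n) M
det-swap-rows {suc m} zero M = begin
  det (suc (suc m)) (M ∘ swap zero)                      ≡⟨ det-expand-pairs (M ∘ swap zero) ⟩
  sum (λ a → sum (pairTerm (M ∘ swap zero) a))           ≡⟨ sum-cong-≗ (λ a → trans (sum-cong-≗ (pairTerm-swap M a)) (sum-neg (λ b → pairTerm M b a))) ⟩
  sum (λ a → - sum (λ b → pairTerm M b a))               ≡⟨ sum-neg (λ a → sum (λ b → pairTerm M b a)) ⟩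
  - sum (λ a → sum (λ b → pairTerm M b a))               ≡⟨ cong -_ (∑-comm (λ a b → pairTerm M b a)) ⟩
  - sum (λ b → sum (pairTerm M b))                       ≡⟨ cong -_ (det-expand-pairs M) ⟨
  - det (suc (suc m)) M                                  ∎
det-swap-rows {suc m} (suc e) M = begin
  det (suc (suc m)) (M ∘ swap (suc e))                   ≡⟨ det-expand (M ∘ swap (suc e)) ⟩
  sum (expansionTerm (M ∘ swap (suc e)))                 ≡⟨ sum-cong-≗ term ⟩
  sum (λ j → - expansionTerm M j)                        ≡⟨ sum-neg (expansionTerm M) ⟩
  - sum (expansionTerm M)                                ≡⟨ cong -_ (det-expand M) ⟨
  - det (suc (suc m)) M                                  ∎
  where
  term : ∀ j → expansionTerm (M ∘ swap (suc e)) j ≡ - expansionTerm M j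
  term j = trans (cong (λ d → sign (toℕ j) * (M zero j * d)) (det-swap-rows e (minor M j)))
                 (negate-minor (sign (toℕ j)) (M zero j) (det (suc m) (minor M j)))

-- Row and column operations

punchIn-↑ˡ : ∀ {k} m (i : Fin (suc k)) (c : Fin k) → punchIn (i ↑ˡ m) (c ↑ˡ m) ≡ punchIn i c ↑ˡ m
punchIn-↑ˡ m zero    c       = refl
punchIn-↑ˡ m (suc i) zero    = refl
punchIn-↑ˡ m (suc i) (suc c) = cong suc (punchIn-↑ˡ m i c)

punchIn-↑ˡ-↑ʳ : ∀ {k m} (i : Fin (suc k)) (c : Fin m) → punchIn (i ↑ˡ m) (k ↑ʳ c) ≡ suc k ↑ʳ c
punchIn-↑ˡ-↑ʳ {k}     zero    c = refl
punchIn-↑ˡ-↑ʳ {suc k} (suc i) c = cong suc (punchIn-↑ˡ-↑ʳ i c)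

det-block-lower-triangular : ∀ k {m} (M : Matrix (k ℕ.+ m)) {X : Matrix k} {Z : Matrix m} →
                             (∀ i j → M (i ↑ˡ m) (k ↑ʳ j) ≡ + 0) →
                             (∀ i j → M (i ↑ˡ m) (j ↑ˡ m) ≡ X i j) →
                             (∀ i j → M (k ↑ʳ i) (k ↑ʳ j) ≡ Z i j) →
                             det (k ℕ.+ m) M ≡ det k X * det m Z
det-block-lower-triangular zero    M         _     _  Z≗ = trans (det-cong Z≗) (sym (ℤ.*-identityˡ _))
det-block-lower-triangular (suc k) {m} M {X} {Z} zeros X≗ Z≗ = begin
  det (suc k ℕ.+ m) M                                                    ≡⟨ det-expand M ⟩
  sum (expansionTerm M)                                                  ≡⟨ sum-↑ (suc k) (expansionTerm M) ⟩
  sum (λ i → expansionTerm M (i ↑ˡ m)) + sum (λ j → expansionTerm M (suc k ↑ʳ j))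
                                                                         ≡⟨ cong₂ _+_ (sum-cong-≗ upper) (sum-zero lower) ⟩
  sum (λ i → expansionTerm X i * det m Z) + + 0                          ≡⟨ +-identityʳ _ ⟩
  sum (λ i → expansionTerm X i * det m Z)                                ≡⟨ *-distribʳ-sum (det m Z) (expansionTerm X) ⟨
  sum (expansionTerm X) * det m Z                                        ≡⟨ cong (_* det m Z) (det-expand X) ⟨
  det (suc k) X * det m Z                                                ∎
  where
  upper : ∀ i → expansionTerm M (i ↑ˡ m) ≡ expansionTerm X i * det m Z
  upper i = begin
    sign (toℕ (i ↑ˡ m)) * (M zero (i ↑ˡ m) * det (k ℕ.+ m) (minor M (i ↑ˡ m)))
      ≡⟨ cong (λ s → s * (M zero (i ↑ˡ m) * det (k ℕ.+ m) (minor M (i ↑ˡ m)))) (cong sign (toℕ-↑ˡ i m)) ⟩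
    sign (toℕ i) * (M zero (i ↑ˡ m) * det (k ℕ.+ m) (minor M (i ↑ˡ m)))
      ≡⟨ cong₂ (λ a d → sign (toℕ i) * (a * d)) (X≗ zero i) minor-det ⟩
    sign (toℕ i) * (X zero i * (det k (minor X i) * det m Z))
      ≡⟨ reassoc (sign (toℕ i)) (X zero i) (det k (minor X i)) (det m Z) ⟩
    expansionTerm X i * det m Z ∎
    where
    reassoc : ∀ s x d z → s * (x * (d * z)) ≡ (s * (x * d)) * z
    reassoc = solve-∀
    minor-det : det (k ℕ.+ m) (minor M (i ↑ˡ m)) ≡ det k (minor X i) * det m Z
    minor-det = det-block-lower-triangular k (minor M (i ↑ˡ m))
      (λ r c → trans (cong (M (suc r ↑ˡ m)) (punchIn-↑ˡ-↑ʳ i c)) (zeros (suc r) c))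
      (λ r c → trans (cong (M (suc r ↑ˡ m)) (punchIn-↑ˡ m i c)) (X≗ (suc r) (punchIn i c)))
      (λ r c → trans (cong (M (suc k ↑ʳ r)) (punchIn-↑ˡ-↑ʳ i c)) (Z≗ r c))
  lower : ∀ j → expansionTerm M (suc k ↑ʳ j) ≡ + 0
  lower j = trans (cong (λ a → sign (toℕ (suc k ↑ʳ j)) * (a * det (k ℕ.+ m) (minor M (suc k ↑ʳ j)))) (zeros zero j))
                  (*-zeroʳ (sign (toℕ (suc k ↑ʳ j))))

_ᵀ : ∀ {n} → Matrix n → Matrix n
(M ᵀ) i j = M j i

addLines : ∀ {n} → (Fin n → ℤ) → (Fin n → Fin n) → Matrix n → Matrix n
addLines coef src u r c = u r c + coef r * u (src r) c

swap-invisible : ∀ {n} {A : Set} (g : Fin (suc n) → A) (e : Fin n) → g (inject₁ e) ≡ g (suc e) → ∀ r → g (swap e r) ≡ g r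
swap-invisible g e g-e≡g-e+1 r with r Fin.≟ inject₁ e | r Fin.≟ suc e
... | yes refl | _        = trans (cong g (swap-inject₁ e)) (sym g-e≡g-e+1)
... | no _     | yes refl = trans (cong g (swap-suc e)) g-e≡g-e+1
... | no r≢e   | no r≢e+1 = cong g (swap-other e r≢e r≢e+1)

i≡-i⇒i≡0 : ∀ {i : ℤ} → i ≡ - i → i ≡ + 0
i≡-i⇒i≡0 {+ zero}    _  = refl
i≡-i⇒i≡0 {+ suc _}   ()
i≡-i⇒i≡0 { -[1+ _ ]} ()

-- Line operations for any function of the lines (rows, or columns) of a square array that is alternating under
-- adjacent swaps and linear in each line.
module LineOperations {n : ℕ} (f : Matrix (suc n) → ℤ)
  (f-cong   : ∀ {u v} → (∀ r c → u r c ≡ v r c) → f u ≡ f v)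
  (f-swap   : ∀ e u → f (u ∘ swap e) ≡ - f u)
  (f-linear : ∀ r x {u v w} → (∀ s c → s ≢ r → u s c ≡ v s c) → (∀ s c → s ≢ r → u s c ≡ w s c) →
              (∀ c → u r c ≡ v r c + x * w r c) → f u ≡ f v + x * f w)
  where

  private
    equal-at-distance : ∀ t u c (e : Fin n) → toℕ e ≡ toℕ c ℕ.+ t → (∀ k → u c k ≡ u (suc e) k) → f u ≡ + 0
    equal-at-distance zero u c e e≡c uc≗ue+1 = i≡-i⇒i≡0 (trans (f-cong swapped) (f-swap e u))
      where
      c≡e : c ≡ inject₁ e
      c≡e = toℕ-injective (trans (sym (ℕ.+-identityʳ (toℕ c))) (trans (sym e≡c) (sym (toℕ-inject₁ e))))
      swapped : ∀ r k → u r k ≡ u (swap e r) k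
      swapped r k = sym (swap-invisible (λ r → u r k) e (trans (cong (λ r → u r k) (sym c≡e)) (uc≗ue+1 k)) r)
    equal-at-distance (suc t) u c zero    0≡c+t+1 _ = ⊥-elim (ℕ.0≢1+n (trans 0≡c+t+1 (ℕ.+-suc (toℕ c) t)))
    equal-at-distance (suc t) u c (suc e) e+1≡c+t+1 uc≗ue+1 = begin
      f u          ≡⟨ neg-involutive (f u) ⟨
      - - f u      ≡⟨ cong -_ (f-swap (suc e) u) ⟨
      - f u′       ≡⟨ cong -_ (equal-at-distance t u′ c (inject₁ e) e≡c+t u′c≗u′e+1) ⟩
      + 0          ∎
      where
      u′ = u ∘ swap (suc e)
      e≡c+t : toℕ (inject₁ e) ≡ toℕ c ℕ.+ t
      e≡c+t = ℕ.suc-injective (trans (cong suc (toℕ-inject₁ e)) (trans e+1≡c+t+1 (ℕ.+-suc (toℕ c) t)))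
      c<e+1 : toℕ c ℕ.< toℕ (inject₁ (suc e))
      c<e+1 = ℕ.≤-<-trans (ℕ.m≤m+n (toℕ c) t) (ℕ.s≤s (ℕ.≤-reflexive (sym e≡c+t)))
      u′c≗u′e+1 : ∀ k → u′ c k ≡ u′ (suc (inject₁ e)) k
      u′c≗u′e+1 k = begin
        u (swap (suc e) c) k  ≡⟨ cong (λ r → u r k) (swap-other (suc e) (λ c≡ → ℕ.<-irrefl (cong toℕ c≡) c<e+1)
                                   (λ c≡ → ℕ.<-irrefl (cong toℕ c≡) (ℕ.<-trans c<e+1 (ℕ.≤-reflexive (cong suc (toℕ-inject₁ (suc e))))))) ⟩
        u c k                  ≡⟨ uc≗ue+1 k ⟩
        u (suc (suc e)) k      ≡⟨ cong (λ r → u r k) (swap-inject₁ (suc e)) ⟨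
        u′ (suc (inject₁ e)) k ∎

    equal-below : ∀ u {c d} → toℕ c ℕ.< toℕ d → (∀ k → u c k ≡ u d k) → f u ≡ + 0
    equal-below u {c} {suc e} (ℕ.s≤s c≤e) = equal-at-distance (toℕ e ℕ.∸ toℕ c) u c e (sym (ℕ.m+[n∸m]≡n c≤e))

  f-equal-lines : ∀ u {c d} → c ≢ d → (∀ k → u c k ≡ u d k) → f u ≡ + 0
  f-equal-lines u {c} {d} c≢d uc≗ud with ℕ.<-cmp (toℕ c) (toℕ d)
  ... | tri< c<d _ _ = equal-below u c<d uc≗ud
  ... | tri≈ _ c≡d _ = ⊥-elim (c≢d (toℕ-injective c≡d))
  ... | tri> _ _ d<c = equal-below u d<c (sym ∘ uc≗ud)

  f-add-multiple : ∀ {u v} {r s} x → r ≢ s → (∀ t c → t ≢ r → v t c ≡ u t c) → (∀ c → v r c ≡ u r c + x * u s c) → f v ≡ f u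
  f-add-multiple {u} {v} {r} {s} x r≢s v≗u vr≡ = begin
    f v              ≡⟨ f-linear r x {v} {u} {w} v≗u (λ t c t≢r → trans (v≗u t c t≢r) (sym (cong (λ l → l c) (updateAt-minimal t r u t≢r))))
                                                      (λ c → trans (vr≡ c) (cong (λ l → u r c + x * l c) (sym (updateAt-updates r u)))) ⟩
    f u + x * f w    ≡⟨ cong (λ z → f u + x * z) (f-equal-lines w r≢s ws≗wr) ⟩
    f u + x * + 0    ≡⟨ cong (_+_ (f u)) (*-zeroʳ x) ⟩
    f u + + 0        ≡⟨ +-identityʳ (f u) ⟩
    f u              ∎
    where
    w = updateAt u r (const (u s))
    ws≗wr : ∀ k → w r k ≡ w s k
    ws≗wr k = trans (cong (λ l → l k) (updateAt-updates r u)) (sym (cong (λ l → l k) (updateAt-minimal s r u (r≢s ∘ sym))))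

  private
    upTo : ℕ → (Fin (suc n) → ℤ) → Fin (suc n) → ℤ
    upTo t coef r with toℕ r ℕ.<? t
    ... | yes _ = coef r
    ... | no _  = + 0

    upTo-zero : ∀ t coef r → coef r ≡ + 0 → upTo t coef r ≡ + 0
    upTo-zero t coef r coef≡0 with toℕ r ℕ.<? t
    ... | yes _ = coef≡0
    ... | no _  = refl

    upTo-suc-at : ∀ t coef r → toℕ r ≡ t → upTo (suc t) coef r ≡ coef r × upTo t coef r ≡ + 0
    upTo-suc-at t coef r r≡t with toℕ r ℕ.<? suc t | toℕ r ℕ.<? t
    ... | yes _ | no _   = refl , refl
    ... | no r≮t+1 | _   = ⊥-elim (r≮t+1 (ℕ.s≤s (ℕ.≤-reflexive r≡t)))
    ... | _ | yes r<t    = ⊥-elim (ℕ.<-irrefl r≡t r<t)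

    upTo-suc-other : ∀ t coef r → toℕ r ≢ t → upTo (suc t) coef r ≡ upTo t coef r
    upTo-suc-other t coef r r≢t with toℕ r ℕ.<? suc t | toℕ r ℕ.<? t
    ... | yes _    | yes _    = refl
    ... | no _     | no _     = refl
    ... | yes r<t+1 | no r≮t  = ⊥-elim (r≢t (ℕ.≤-antisym (ℕ.≤-pred r<t+1) (ℕ.≮⇒≥ r≮t)))
    ... | no r≮t+1 | yes r<t  = ⊥-elim (r≮t+1 (ℕ.m<n⇒m<1+n r<t))

    upTo-all : ∀ coef r → upTo (suc n) coef r ≡ coef r
    upTo-all coef r with toℕ r ℕ.<? suc n
    ... | yes _    = refl
    ... | no r≮n+1 = ⊥-elim (r≮n+1 (toℕ<n r))

  f-addLines : ∀ coef src u → (∀ r → coef r ≡ + 0 ⊎ coef (src r) ≡ + 0) → f (addLines coef src u) ≡ f u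
  f-addLines coef src u sources-fixed = begin
    f (addLines coef src u)               ≡⟨ f-cong (λ r c → cong (λ x → u r c + x * u (src r) c) (sym (upTo-all coef r))) ⟩
    f (addLines (upTo (suc n) coef) src u) ≡⟨ processed (suc n) ⟩
    f u                                   ∎
    where
    processed : ∀ t → f (addLines (upTo t coef) src u) ≡ f u
    processed zero    = f-cong (λ r c → +-identityʳ (u r c))
    processed (suc t) with t ℕ.<? suc n
    ... | no t≮n+1 = trans (f-cong (λ r c → cong (λ x → u r c + x * u (src r) c)
                             (upTo-suc-other t coef r (λ r≡t → t≮n+1 (subst (ℕ._< suc n) r≡t (toℕ<n r))))))
                           (processed t)
    ... | yes t<n+1 = trans (step (sources-fixed r₀)) (processed t)
      where
      r₀ = Fin.fromℕ< t<n+1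
      r₀≡t = toℕ-fromℕ< t<n+1
      current = addLines (upTo t coef) src u
      others : ∀ r c → r ≢ r₀ → addLines (upTo (suc t) coef) src u r c ≡ current r c
      others r c r≢r₀ = cong (λ x → u r c + x * u (src r) c)
                             (upTo-suc-other t coef r (λ r≡t → r≢r₀ (toℕ-injective (trans r≡t (sym r₀≡t)))))
      at-r₀ : addLines (upTo (suc t) coef) src u r₀ ≗ λ c → u r₀ c + coef r₀ * u (src r₀) c
      at-r₀ c = cong (λ x → u r₀ c + x * u (src r₀) c) (proj₁ (upTo-suc-at t coef r₀ r₀≡t))
      unchanged : ∀ r → upTo t coef r ≡ + 0 → ∀ c → current r c ≡ u r c
      unchanged r coef≡0 c = trans (cong (λ x → u r c + x * u (src r) c) coef≡0) (+-identityʳ (u r c))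
      step : coef r₀ ≡ + 0 ⊎ coef (src r₀) ≡ + 0 → f (addLines (upTo (suc t) coef) src u) ≡ f current
      step (inj₁ coef≡0) = f-cong λ r c → cong (λ x → u r c + x * u (src r) c) (agree r)
        where
        agree : ∀ r → upTo (suc t) coef r ≡ upTo t coef r
        agree r with r Fin.≟ r₀
        ... | yes refl = trans (proj₁ (upTo-suc-at t coef r r₀≡t))
                               (trans coef≡0 (sym (proj₂ (upTo-suc-at t coef r r₀≡t))))
        ... | no r≢r₀  = upTo-suc-other t coef r (λ r≡t → r≢r₀ (toℕ-injective (trans r≡t (sym r₀≡t))))
      step (inj₂ src-fixed) with r₀ Fin.≟ src r₀
      ... | yes r₀≡src = step (inj₁ (trans (cong coef r₀≡src) src-fixed))
      ... | no r₀≢src  = f-add-multiple (coef r₀) r₀≢src others λ c →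
        trans (at-r₀ c) (cong₂ (λ a b → a + coef r₀ * b)
                               (sym (unchanged r₀ (proj₂ (upTo-suc-at t coef r₀ r₀≡t)) c))
                               (sym (unchanged (src r₀) (upTo-zero t coef (src r₀) src-fixed) c)))

det-addRows : ∀ {n} coef src (M : Matrix (suc n)) → (∀ r → coef r ≡ + 0 ⊎ coef (src r) ≡ + 0) →
              det (suc n) (addLines coef src M) ≡ det (suc n) M
det-addRows {n} = LineOperations.f-addLines (det (suc n)) det-cong det-swap-rows (λ r x → det-linear-row r x)

det-addColumns : ∀ {n} coef src (M : Matrix (suc n)) → (∀ c → coef c ≡ + 0 ⊎ coef (src c) ≡ + 0) →
                 det (suc n) (addLines coef src (M ᵀ) ᵀ) ≡ det (suc n) M
det-addColumns {n} coef src M = LineOperations.f-addLines (det (suc n) ∘ _ᵀ)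
  (λ u≗v → det-cong (λ i k → u≗v k i))
  (λ e u → det-swap-columns e (u ᵀ))
  (λ c x u≗v u≗w uc → det-linear-column c x (λ i k k≢c → u≗v k i k≢c) (λ i k k≢c → u≗w k i k≢c) uc)
  coef src (M ᵀ)

-- Cyclic band matrices

ind : Bool → ℤ
ind b = if b then + 1 else + 0

δ : ℕ → ℕ → ℤ
δ x y = ind (x ≡ᵇ y)

path : ℕ → ℕ → ℤ
path x y = δ (suc x) y + δ (suc y) x

band : ℤ → ℕ → ℕ → ℤ
band α (suc x)       (suc y)       = band α x y
band α zero          zero          = α
band α zero          (suc zero)    = + 1
band α (suc zero)    zero          = + 1
band α zero          (suc (suc _)) = + 0
band α (suc (suc _)) zero          = + 0

band≡ : ∀ α x y → band α x y ≡ α * δ y x + path x y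
band≡ α (suc x)       (suc y)       = band≡ α x y
band≡ α zero          zero          = sym (trans (+-identityʳ (α * + 1)) (ℤ.*-identityʳ α))
band≡ α zero          (suc zero)    = sym (cong (_+ + 1) (*-zeroʳ α))
band≡ α (suc zero)    zero          = sym (cong (_+ + 1) (*-zeroʳ α))
band≡ α zero          (suc (suc y)) = sym (cong (_+ + 0) (*-zeroʳ α))
band≡ α (suc (suc x)) zero          = sym (cong (_+ + 0) (*-zeroʳ α))

-- The square matrix of size L + 1 whose columns 1 .. L − 1 are those of the band, with first column u and last column v.
borderedEntry : ℤ → ℕ → (ℕ → ℤ) → (ℕ → ℤ) → ℕ → ℕ → ℤ
borderedEntry α L u v x zero    = u x
borderedEntry α L u v x (suc y) = if L ≡ᵇ suc y then v x else band α x (suc y)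

borderedBand : ℤ → (L : ℕ) → (ℕ → ℤ) → (ℕ → ℤ) → Matrix (suc L)
borderedBand α L u v i j = borderedEntry α L u v (toℕ i) (toℕ j)

borderedBand-cong : ∀ α L {u u′ v v′ : ℕ → ℤ} → (∀ x → u x ≡ u′ x) → (∀ x → v x ≡ v′ x) →
                    det (suc L) (borderedBand α L u v) ≡ det (suc L) (borderedBand α L u′ v′)
borderedBand-cong α L {u} {u′} {v} {v′} u≗u′ v≗v′ = det-cong {suc L} λ i j → entry (toℕ i) (toℕ j)
  where
  entry : ∀ x y → borderedEntry α L u v x y ≡ borderedEntry α L u′ v′ x y
  entry x zero    = u≗u′ x
  entry x (suc y) with L ≡ᵇ suc y
  ... | true  = v≗v′ x
  ... | false = refl

-- The first and last column after clearing row 0 with column 1 and deleting both.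
shiftColumn : ℤ → (ℕ → ℤ) → ℕ → ℤ
shiftColumn α u x = u (suc x) + - u 0 * band α x 0

-- Row 0 is (u 0, 1, 0, …, 0, v 0): subtracting multiples of column 1 from the first and last columns
-- leaves a single entry 1 in row 0, and its minor is again a bordered band.
det-borderedBand-step : ∀ α L u v →
  det (3 ℕ.+ L) (borderedBand α (2 ℕ.+ L) u v) ≡ - det (2 ℕ.+ L) (borderedBand α (suc L) (shiftColumn α u) (shiftColumn α v))
det-borderedBand-step α L u v = begin
  det (3 ℕ.+ L) B                                     ≡⟨ det-addColumns coef (const (suc zero)) B (λ _ → inj₂ refl) ⟨
  det (3 ℕ.+ L) B′                                    ≡⟨ det-expand B′ ⟩
  sum (expansionTerm B′)                              ≡⟨ sum-single (expansionTerm B′) (suc zero) row₀ ⟩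
  -1ℤ * (+ 1 * det (2 ℕ.+ L) (minor B′ (suc zero)))   ≡⟨ unit-pivot (det (2 ℕ.+ L) (minor B′ (suc zero))) ⟩
  - det (2 ℕ.+ L) (minor B′ (suc zero))               ≡⟨ cong -_ (det-cong minor≗) ⟩
  - det (2 ℕ.+ L) (borderedBand α (suc L) (shiftColumn α u) (shiftColumn α v)) ∎
  where
  B = borderedBand α (2 ℕ.+ L) u v
  coefℕ : ℕ → ℤ
  coefℕ zero    = - u 0
  coefℕ (suc y) = if 2 ℕ.+ L ≡ᵇ suc y then - v 0 else + 0
  coef : Fin (3 ℕ.+ L) → ℤ
  coef c = coefℕ (toℕ c)
  B′ = addLines coef (const (suc zero)) (B ᵀ) ᵀ

  unit-pivot : ∀ d → -1ℤ * (+ 1 * d) ≡ - d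
  unit-pivot = solve-∀
  cancel : ∀ a → a + - a * + 1 ≡ + 0
  cancel = solve-∀

  row₀ : ∀ j → j ≢ suc zero → expansionTerm B′ j ≡ + 0
  row₀ j j≢1 = trans (cong (λ a → sign (toℕ j) * (a * det (2 ℕ.+ L) (minor B′ j))) (entry j j≢1)) (*-zeroʳ (sign (toℕ j)))
    where
    entry : ∀ j → j ≢ suc zero → B′ zero j ≡ + 0
    entry zero             _   = cancel (u 0)
    entry (suc zero)       j≢1 = ⊥-elim (j≢1 refl)
    entry (suc (suc j))    _ with L ≡ᵇ toℕ j
    ... | true  = cancel (v 0)
    ... | false = refl

  minor≗ : ∀ i k → minor B′ (suc zero) i k ≡ borderedBand α (suc L) (shiftColumn α u) (shiftColumn α v) i k
  minor≗ i zero    = refl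
  minor≗ i (suc k) with L ≡ᵇ toℕ k
  ... | true  = refl
  ... | false = +-identityʳ _

-- The effect of shiftColumn on the top two entries (p , q) of the first or last column.
shift : ℤ → ℤ × ℤ → ℤ × ℤ
shift α (p , q) = q + - p * α , - p

shiftⁿ : ℤ → ℕ → ℤ × ℤ → ℤ × ℤ
shiftⁿ α zero    a = a
shiftⁿ α (suc t) a = shiftⁿ α t (shift α a)

firstColumn : ℤ × ℤ → ℤ → ℕ → ℕ → ℤ
firstColumn (p , q) β L x = p * δ 0 x + q * δ 1 x + β * δ L x

lastColumn : ℤ → ℤ × ℤ → ℕ → ℕ → ℤ
lastColumn α (p , q) L x = p * δ 0 x + q * δ 1 x + band α x L

shiftColumn-first : ∀ α a β L x → shiftColumn α (firstColumn a β (suc L)) x ≡ firstColumn (shift α a) β L x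
shiftColumn-first α (p , q) β L x =
  trans (cong (λ b → (p * + 0 + q * δ 0 x + β * δ L x) + - (p * + 1 + q * + 0 + β * + 0) * b) (band≡ α x 0))
        (rearrange p q β α (δ 0 x) (δ 1 x) (δ L x))
  where
  rearrange : ∀ p q β α d₀ d₁ dL → (p * + 0 + q * d₀ + β * dL) + - (p * + 1 + q * + 0 + β * + 0) * (α * d₀ + (+ 0 + d₁))
                              ≡ (q + - p * α) * d₀ + - p * d₁ + β * dL
  rearrange = solve-∀

shiftColumn-last : ∀ α b L x → shiftColumn α (lastColumn α b (2 ℕ.+ L)) x ≡ lastColumn α (shift α b) (suc L) x
shiftColumn-last α (p , q) L x =
  trans (cong (λ b → (p * + 0 + q * δ 0 x + band α x (suc L)) + - (p * + 1 + q * + 0 + + 0) * b) (band≡ α x 0))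
        (rearrange p q α (δ 0 x) (δ 1 x) (band α x (suc L)))
  where
  rearrange : ∀ p q α d₀ d₁ B → (p * + 0 + q * d₀ + B) + - (p * + 1 + q * + 0 + + 0) * (α * d₀ + (+ 0 + d₁))
                           ≡ (q + - p * α) * d₀ + - p * d₁ + B
  rearrange = solve-∀

det-borderedBand-iterate : ∀ α β a b t →
  det (2 ℕ.+ t) (borderedBand α (suc t) (firstColumn a β (suc t)) (lastColumn α b (suc t)))
  ≡ sign t * det 2 (borderedBand α 1 (firstColumn (shiftⁿ α t a) β 1) (lastColumn α (shiftⁿ α t b) 1))
det-borderedBand-iterate α β a b zero    = sym (ℤ.*-identityˡ _)
det-borderedBand-iterate α β a b (suc t) = begin
  det (3 ℕ.+ t) (borderedBand α (2 ℕ.+ t) (firstColumn a β (2 ℕ.+ t)) (lastColumn α b (2 ℕ.+ t)))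
    ≡⟨ det-borderedBand-step α t (firstColumn a β (2 ℕ.+ t)) (lastColumn α b (2 ℕ.+ t)) ⟩
  - det (2 ℕ.+ t) (borderedBand α (suc t) (shiftColumn α (firstColumn a β (2 ℕ.+ t))) (shiftColumn α (lastColumn α b (2 ℕ.+ t))))
    ≡⟨ cong -_ (borderedBand-cong α (suc t) (shiftColumn-first α a β (suc t)) (shiftColumn-last α b t)) ⟩
  - det (2 ℕ.+ t) (borderedBand α (suc t) (firstColumn (shift α a) β (suc t)) (lastColumn α (shift α b) (suc t)))
    ≡⟨ cong -_ (det-borderedBand-iterate α β (shift α a) (shift α b) t) ⟩
  - (sign t * D)
    ≡⟨ neg-distribˡ-* (sign t) D ⟩
  sign (suc t) * D ∎
  where
  D = det 2 (borderedBand α 1 (firstColumn (shiftⁿ α (suc t) a) β 1) (lastColumn α (shiftⁿ α (suc t) b) 1))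

-- The rungs of M_{2(L+1)} between the halves 0 … L and L + 1 … 2L + 1, with the two cycle edges crossing between them.
rung : ℕ → ℕ → ℕ → ℤ
rung L x y = δ L x * δ 0 y + (δ L y * δ 0 x + δ y x)

signedCyclic : ℤ → ℕ → ℕ → ℕ → ℤ
signedCyclic s L x y = path x y + s * rung L x y

signedCyclic≡borderedEntry : ∀ s t x y →
  signedCyclic s (suc t) x y ≡ borderedEntry s (suc t) (firstColumn (s , + 1) s (suc t)) (lastColumn s (s , + 0) (suc t)) x y
signedCyclic≡borderedEntry s t x zero = first s (δ 0 x) (δ 1 x) (δ (suc t) x)
  where
  first : ∀ s d₀ d₁ dL → (+ 0 + d₁) + s * (dL * + 1 + (+ 0 + d₀)) ≡ s * d₀ + + 1 * d₁ + s * dL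
  first = solve-∀
signedCyclic≡borderedEntry s t x (suc y) with t ≡ᵇ y in t≡ᵇy
... | true  = at-last (ℕ.≡ᵇ⇒≡ t y (subst T (sym t≡ᵇy) _))
  where
  last : ∀ s P d₀ dL → P + s * (dL * + 0 + (+ 1 * d₀ + dL)) ≡ s * d₀ + + 0 + (s * dL + P)
  last = solve-∀
  at-last : t ≡ y → path x (suc y) + s * (δ (suc t) x * + 0 + (+ 1 * δ 0 x + δ (suc y) x)) ≡ s * δ 0 x + + 0 + band s x (suc t)
  at-last refl = trans (last s (path x (suc t)) (δ 0 x) (δ (suc t) x)) (cong (_+_ (s * δ 0 x + + 0)) (sym (band≡ s x (suc t))))
... | false = trans (middle s (path x (suc y)) (δ (suc t) x) (δ (suc y) x)) (sym (band≡ s x (suc y)))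
  where
  middle : ∀ s P dL d → P + s * (dL * + 0 + (+ 0 + d)) ≡ s * d + P
  middle = solve-∀

-- The adjacency matrix of the Möbius ladder

≡ᵇ-refl : ∀ a → (a ≡ᵇ a) ≡ true
≡ᵇ-refl zero    = refl
≡ᵇ-refl (suc a) = ≡ᵇ-refl a

≡ᵇ-sym : ∀ a b → (a ≡ᵇ b) ≡ (b ≡ᵇ a)
≡ᵇ-sym zero    zero    = refl
≡ᵇ-sym zero    (suc b) = refl
≡ᵇ-sym (suc a) zero    = refl
≡ᵇ-sym (suc a) (suc b) = ≡ᵇ-sym a b

≢⇒≡ᵇ-false : ∀ {a b} → a ≢ b → (a ≡ᵇ b) ≡ false
≢⇒≡ᵇ-false {a} {b} a≢b with a ≡ᵇ b in eq
... | true  = ⊥-elim (a≢b (ℕ.≡ᵇ⇒≡ a b (subst T (sym eq) _)))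
... | false = refl

+-≡ᵇ : ∀ k a b → (k ℕ.+ a ≡ᵇ k ℕ.+ b) ≡ (a ≡ᵇ b)
+-≡ᵇ zero    a b = refl
+-≡ᵇ (suc k) a b = +-≡ᵇ k a b

ind-∧ : ∀ a b → ind (a ∧ b) ≡ ind a * ind b
ind-∧ true  true  = refl
ind-∧ true  false = refl
ind-∧ false b     = refl

ind-∨₃ : ∀ p q r → p ∧ q ≡ false → p ∧ r ≡ false → q ∧ r ≡ false → ind (p ∨ (q ∨ r)) ≡ ind p + (ind q + ind r)
ind-∨₃ true  true  _     () _  _
ind-∨₃ true  false true  _  () _
ind-∨₃ true  false false _  _  _  = refl
ind-∨₃ false true  true  _  _  ()
ind-∨₃ false true  false _  _  _  = refl
ind-∨₃ false false true  _  _  _  = refl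
ind-∨₃ false false false _  _  _  = refl

-- x is the last index L and y the first, as for the cycle edges v_{L+1} v_{L+2} and v_{2L+2} v_1.
corner : ℕ → ℕ → ℕ → Bool
corner L x y = (L ≡ᵇ x) ∧ (0 ≡ᵇ y)

successors-exclusive : ∀ x y → (suc x ≡ᵇ y) ∧ (suc y ≡ᵇ x) ≡ false
successors-exclusive x       zero    = refl
successors-exclusive zero    (suc y) = ∧-zeroʳ _
successors-exclusive (suc x) (suc y) = successors-exclusive x y

corners-exclusive : ∀ t x y → corner (suc t) x y ∧ corner (suc t) y x ≡ false
corners-exclusive t zero    y       = refl
corners-exclusive t (suc x) zero    = ∧-zeroʳ _
corners-exclusive t (suc x) (suc y) = cong (_∧ ((t ≡ᵇ y) ∧ false)) (∧-zeroʳ (t ≡ᵇ x))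

corner-diagonal-exclusive : ∀ t x y → corner (suc t) x y ∧ (y ≡ᵇ x) ≡ false
corner-diagonal-exclusive t zero    zero    = refl
corner-diagonal-exclusive t (suc x) zero    = ∧-zeroʳ _
corner-diagonal-exclusive t x       (suc y) = cong (_∧ (suc y ≡ᵇ x)) (∧-zeroʳ (suc t ≡ᵇ x))

path≡ind : ∀ x y → ind ((suc x ≡ᵇ y) ∨ ((suc y ≡ᵇ x) ∨ false)) ≡ path x y
path≡ind x y = trans (ind-∨₃ (suc x ≡ᵇ y) (suc y ≡ᵇ x) false (successors-exclusive x y) (∧-zeroʳ _) (∧-zeroʳ _))
                     (cong (_+_ (δ (suc x) y)) (+-identityʳ (δ (suc y) x)))

rung≡ind : ∀ t x y → ind (corner (suc t) x y ∨ (corner (suc t) y x ∨ (y ≡ᵇ x))) ≡ rung (suc t) x y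
rung≡ind t x y = trans (ind-∨₃ (corner L x y) (corner L y x) (y ≡ᵇ x)
                              (corners-exclusive t x y) (corner-diagonal-exclusive t x y)
                              (trans (cong (corner L y x ∧_) (≡ᵇ-sym y x)) (corner-diagonal-exclusive t y x)))
                       (cong₂ (λ a b → a + (b + δ y x)) (ind-∧ (L ≡ᵇ x) (0 ≡ᵇ y)) (ind-∧ (L ≡ᵇ y) (0 ≡ᵇ x)))
  where
  L = suc t

module _ (L : ℕ) where

  private
    N : ℕ
    N = 2 ℕ.* suc L

    N≡n+n : N ≡ suc L ℕ.+ suc L
    N≡n+n = cong (suc L ℕ.+_) (ℕ.+-identityʳ (suc L))

    mod-small : ∀ {a} → a < suc L ℕ.+ suc L → a % N ≡ a
    mod-small {a} a< = m<n⇒m%n≡m (subst (a <_) (sym N≡n+n) a<)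

    successor-small : ∀ {x} → x ≤ L → suc x < suc L ℕ.+ suc L
    successor-small x≤L = ℕ.≤-<-trans (s≤s x≤L) (ℕ.m<m+n (suc L) (s≤s z≤n))

    mod-last : suc (suc L ℕ.+ L) % N ≡ 0
    mod-last = trans (cong (_% N) (trans (sym (ℕ.+-suc (suc L) L)) (sym N≡n+n))) (n%n≡0 N)

    mod-upper : ∀ {x} → x ≤ L → (x ℕ.+ suc L) % N ≡ x ℕ.+ suc L
    mod-upper x≤L = mod-small (ℕ.+-monoˡ-< (suc L) (s≤s x≤L))

    mod-lower : ∀ {x} → x ≤ L → (suc L ℕ.+ x ℕ.+ suc L) % N ≡ x
    mod-lower {x} x≤L = begin
      (suc L ℕ.+ x ℕ.+ suc L) % N  ≡⟨ cong (_% N) (trans (ℕ.+-comm (suc L ℕ.+ x) (suc L)) (sym (ℕ.+-assoc (suc L) (suc L) x))) ⟩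
      (suc L ℕ.+ suc L ℕ.+ x) % N  ≡⟨ cong (λ m → (m ℕ.+ x) % N) N≡n+n ⟨
      (N ℕ.+ x) % N                ≡⟨ cong (_% N) (ℕ.+-comm N x) ⟩
      (x ℕ.+ N) % N                ≡⟨ [m+n]%n≡m%n x N ⟩
      x % N                        ≡⟨ mod-small (ℕ.<-trans (s≤s x≤L) (ℕ.m<m+n (suc L) (s≤s z≤n))) ⟩
      x                            ∎

    below-upper : ∀ {x a} → x ≤ L → (x ≡ᵇ suc L ℕ.+ a) ≡ false
    below-upper {x} {a} x≤L = ≢⇒≡ᵇ-false (λ eq → ℕ.<-irrefl eq (ℕ.≤-<-trans x≤L (ℕ.<-≤-trans (ℕ.n<1+n L) (ℕ.m≤m+n (suc L) a))))

    successor-lower : ∀ x y → x ≤ L → (suc x % N ≡ᵇ y) ≡ (suc x ≡ᵇ y)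
    successor-lower x y x≤L = cong (_≡ᵇ y) (mod-small (successor-small x≤L))

    successor-upper : ∀ x y → x ≤ L → y ≤ L → (suc (suc L ℕ.+ x) % N ≡ᵇ suc L ℕ.+ y) ≡ (suc x ≡ᵇ y)
    successor-upper x y x≤L y≤L with ℕ.m≤n⇒m<n∨m≡n x≤L
    ... | inj₁ x<L  = trans (cong (_≡ᵇ suc L ℕ.+ y) (trans (cong (_% N) (sym (ℕ.+-suc (suc L) x)))
                                                           (mod-small (ℕ.+-monoʳ-< (suc L) (s≤s x<L)))))
                            (+-≡ᵇ (suc L) (suc x) y)
    ... | inj₂ refl = trans (cong (_≡ᵇ suc L ℕ.+ y) mod-last) (sym (≢⇒≡ᵇ-false (λ eq → ℕ.<-irrefl (sym eq) (s≤s y≤L))))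

    successor-wraps : ∀ x y → x ≤ L → y ≤ L → (suc (suc L ℕ.+ x) % N ≡ᵇ y) ≡ corner L x y
    successor-wraps x y x≤L y≤L with ℕ.m≤n⇒m<n∨m≡n x≤L
    ... | inj₁ x<L  = begin
      (suc (suc L ℕ.+ x) % N ≡ᵇ y)  ≡⟨ cong (_≡ᵇ y) (trans (cong (_% N) (sym (ℕ.+-suc (suc L) x)))
                                                           (mod-small (ℕ.+-monoʳ-< (suc L) (s≤s x<L)))) ⟩
      (suc L ℕ.+ suc x ≡ᵇ y)        ≡⟨ trans (≡ᵇ-sym _ y) (below-upper y≤L) ⟩
      false                          ≡⟨ cong (_∧ (0 ≡ᵇ y)) (≢⇒≡ᵇ-false (λ eq → ℕ.<-irrefl (sym eq) x<L)) ⟨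
      corner L x y                   ∎
    ... | inj₂ refl = trans (cong (_≡ᵇ y) mod-last) (cong (_∧ (0 ≡ᵇ y)) (sym (≡ᵇ-refl x)))

    successor-crosses : ∀ x y → x ≤ L → (suc x % N ≡ᵇ suc L ℕ.+ y) ≡ corner L x y
    successor-crosses x zero    x≤L = trans (cong (_≡ᵇ suc L ℕ.+ 0) (mod-small (successor-small x≤L)))
                                            (trans (cong (x ≡ᵇ_) (ℕ.+-identityʳ L))
                                                   (trans (≡ᵇ-sym x L) (sym (∧-identityʳ (L ≡ᵇ x)))))
    successor-crosses x (suc y) x≤L = trans (cong (_≡ᵇ suc L ℕ.+ suc y) (mod-small (successor-small x≤L)))
                                            (trans (≢⇒≡ᵇ-false (λ eq → ℕ.<-irrefl eq (ℕ.≤-<-trans x≤L (ℕ.m<m+n L (s≤s z≤n)))))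
                                                   (sym (∧-zeroʳ (L ≡ᵇ x))))

    rung-upper : ∀ x y → x ≤ L → ((x ℕ.+ suc L) % N ≡ᵇ suc L ℕ.+ y) ≡ (y ≡ᵇ x)
    rung-upper x y x≤L = trans (cong (_≡ᵇ suc L ℕ.+ y) (trans (mod-upper x≤L) (ℕ.+-comm x (suc L))))
                               (trans (+-≡ᵇ (suc L) x y) (≡ᵇ-sym x y))

    rung-lower : ∀ x y → x ≤ L → ((suc L ℕ.+ x ℕ.+ suc L) % N ≡ᵇ y) ≡ (y ≡ᵇ x)
    rung-lower x y x≤L = trans (cong (_≡ᵇ y) (mod-lower x≤L)) (≡ᵇ-sym x y)

  private
    entry-cong : ∀ {p p′ q q′ r r′} → p ≡ p′ → q ≡ q′ → r ≡ r′ → ind (p ∨ (q ∨ r)) ≡ ind (p′ ∨ (q′ ∨ r′))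
    entry-cong refl refl refl = refl

    below-rung : ∀ {x y} → y ≤ L → (x ℕ.+ suc L ≡ᵇ y) ≡ false
    below-rung {x} y≤L = ≢⇒≡ᵇ-false (λ eq → ℕ.<-irrefl (sym eq) (ℕ.≤-<-trans y≤L (ℕ.<-≤-trans (ℕ.n<1+n L) (ℕ.m≤n+m (suc L) x))))

  -- A-Mobius (suc L) on vertex numbers, with ⌊ _ ≟ _ ⌋ computed as _≡ᵇ_.
  mobiusEntry : ℕ → ℕ → ℤ
  mobiusEntry x y = ind ((suc x % N ≡ᵇ y) ∨ ((suc y % N ≡ᵇ x) ∨ ((x ℕ.+ suc L) % N ≡ᵇ y)))

  A-Mobius≡mobiusEntry : ∀ i j → A-Mobius (suc L) i j ≡ mobiusEntry (toℕ i) (toℕ j)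
  A-Mobius≡mobiusEntry i j = entry-cong (isYes≗does (suc (toℕ i) % N ℕ.≟ toℕ j)) (isYes≗does (suc (toℕ j) % N ℕ.≟ toℕ i))
                                        (isYes≗does ((toℕ i ℕ.+ suc L) % N ℕ.≟ toℕ j))

  mobiusEntry-upper-upper : ∀ x y → x ≤ L → y ≤ L → mobiusEntry x y ≡ path x y
  mobiusEntry-upper-upper x y x≤L y≤L =
    trans (entry-cong (successor-lower x y x≤L) (successor-lower y x y≤L) (trans (cong (_≡ᵇ y) (mod-upper x≤L)) (below-rung {x} y≤L)))
          (path≡ind x y)

  mobiusEntry-lower-lower : ∀ x y → x ≤ L → y ≤ L → mobiusEntry (suc L ℕ.+ x) (suc L ℕ.+ y) ≡ path x y
  mobiusEntry-lower-lower x y x≤L y≤L =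
    trans (entry-cong (successor-upper x y x≤L y≤L) (successor-upper y x y≤L x≤L)
                      (trans (cong (_≡ᵇ suc L ℕ.+ y) (mod-lower x≤L)) (below-upper x≤L)))
          (path≡ind x y)

  mobiusEntry-upper-lower : ∀ t → L ≡ suc t → ∀ x y → x ≤ L → y ≤ L → mobiusEntry x (suc L ℕ.+ y) ≡ rung L x y
  mobiusEntry-upper-lower t refl x y x≤L y≤L =
    trans (entry-cong (successor-crosses x y x≤L) (successor-wraps y x y≤L x≤L) (rung-upper x y x≤L))
          (rung≡ind t x y)

  mobiusEntry-lower-upper : ∀ t → L ≡ suc t → ∀ x y → x ≤ L → y ≤ L → mobiusEntry (suc L ℕ.+ x) y ≡ rung L x y
  mobiusEntry-lower-upper t refl x y x≤L y≤L =
    trans (entry-cong (successor-wraps x y x≤L y≤L) (successor-crosses y x y≤L) (rung-lower x y x≤L))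
          (rung≡ind t x y)

-- The determinant of A(M_{2n})

-- Vertex r of M_{2n} and its rung partner r ± n, as indices of the two halves of Fin (2 * n).
module _ (n : ℕ) where

  partner : Fin (n ℕ.+ (n ℕ.+ 0)) → Fin (n ℕ.+ (n ℕ.+ 0))
  partner r = [ (λ i → n ↑ʳ (i ↑ˡ 0)) , (λ j → Fin.cast (ℕ.+-identityʳ n) j ↑ˡ (n ℕ.+ 0)) ]′ (splitAt n r)

  halves : ℤ → ℤ → Fin (n ℕ.+ (n ℕ.+ 0)) → ℤ
  halves a b r = [ const a , const b ]′ (splitAt n r)

  partner-↑ˡ : ∀ i → partner (i ↑ˡ (n ℕ.+ 0)) ≡ n ↑ʳ (i ↑ˡ 0)
  partner-↑ˡ i = cong [ _ , _ ]′ (splitAt-↑ˡ n i (n ℕ.+ 0))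

  partner-↑ʳ : ∀ j → partner (n ↑ʳ j) ≡ Fin.cast (ℕ.+-identityʳ n) j ↑ˡ (n ℕ.+ 0)
  partner-↑ʳ j = cong [ _ , _ ]′ (splitAt-↑ʳ n (n ℕ.+ 0) j)

  halves-↑ˡ : ∀ a b i → halves a b (i ↑ˡ (n ℕ.+ 0)) ≡ a
  halves-↑ˡ a b i = cong [ _ , _ ]′ (splitAt-↑ˡ n i (n ℕ.+ 0))

  halves-↑ʳ : ∀ a b j → halves a b (n ↑ʳ j) ≡ b
  halves-↑ʳ a b j = cong [ _ , _ ]′ (splitAt-↑ʳ n (n ℕ.+ 0) j)

  halves-source-fixed : ∀ {a b} → a ≡ + 0 ⊎ b ≡ + 0 → ∀ r → halves a b r ≡ + 0 ⊎ halves a b (partner r) ≡ + 0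
  halves-source-fixed {a} {b} a≡0⊎b≡0 r with splitAt n r | a≡0⊎b≡0
  ... | inj₁ i | inj₁ a≡0 = inj₁ a≡0
  ... | inj₁ i | inj₂ b≡0 = inj₂ (trans (halves-↑ʳ a b (i ↑ˡ 0)) b≡0)
  ... | inj₂ j | inj₁ a≡0 = inj₂ (trans (halves-↑ˡ a b (Fin.cast (ℕ.+-identityʳ n) j)) a≡0)
  ... | inj₂ j | inj₂ b≡0 = inj₁ b≡0

module _ (t : ℕ) where

  private
    L n m : ℕ
    L = suc t
    n = suc L
    m = n ℕ.+ 0
    A B F : Matrix (n ℕ.+ m)
    A = A-Mobius n

    -- Add to each row of the first half the row of its rung partner; then subtract from each column of
    -- the second half the column of its partner.
    B = addLines (halves n (+ 1) (+ 0)) (partner n) A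
    F = addLines (halves n (+ 0) -1ℤ) (partner n) (B ᵀ) ᵀ

    A-entry : ∀ r c {x y} → toℕ r ≡ x → toℕ c ≡ y → A r c ≡ mobiusEntry L x y
    A-entry r c refl refl = A-Mobius≡mobiusEntry L r c

    bound : ∀ (i : Fin m) → toℕ i ≤ L
    bound i = ℕ.≤-pred (subst (toℕ i ℕ.<_) (ℕ.+-identityʳ n) (toℕ<n i))

    upper-upper : ∀ (i j : Fin n) → A (i ↑ˡ m) (j ↑ˡ m) ≡ path (toℕ i) (toℕ j)
    upper-upper i j = trans (A-entry (i ↑ˡ m) (j ↑ˡ m) (toℕ-↑ˡ i m) (toℕ-↑ˡ j m))
                            (mobiusEntry-upper-upper L (toℕ i) (toℕ j) (ℕ.≤-pred (toℕ<n i)) (ℕ.≤-pred (toℕ<n j)))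

    lower-lower : ∀ (i j : Fin m) → A (n ↑ʳ i) (n ↑ʳ j) ≡ path (toℕ i) (toℕ j)
    lower-lower i j = trans (A-entry (n ↑ʳ i) (n ↑ʳ j) (toℕ-↑ʳ n i) (toℕ-↑ʳ n j))
                            (mobiusEntry-lower-lower L (toℕ i) (toℕ j) (bound i) (bound j))

    upper-lower : ∀ (i : Fin n) (j : Fin m) → A (i ↑ˡ m) (n ↑ʳ j) ≡ rung L (toℕ i) (toℕ j)
    upper-lower i j = trans (A-entry (i ↑ˡ m) (n ↑ʳ j) (toℕ-↑ˡ i m) (toℕ-↑ʳ n j))
                            (mobiusEntry-upper-lower L t refl (toℕ i) (toℕ j) (ℕ.≤-pred (toℕ<n i)) (bound j))

    lower-upper : ∀ (i : Fin m) (j : Fin n) → A (n ↑ʳ i) (j ↑ˡ m) ≡ rung L (toℕ i) (toℕ j)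
    lower-upper i j = trans (A-entry (n ↑ʳ i) (j ↑ˡ m) (toℕ-↑ʳ n i) (toℕ-↑ˡ j m))
                            (mobiusEntry-lower-upper L t refl (toℕ i) (toℕ j) (bound i) (ℕ.≤-pred (toℕ<n j)))

    cast : Fin m → Fin n
    cast = Fin.cast (ℕ.+-identityʳ n)

    B-upper : ∀ i c → B (i ↑ˡ m) c ≡ A (i ↑ˡ m) c + + 1 * A (n ↑ʳ (i ↑ˡ 0)) c
    B-upper i c = cong₂ (λ h p → A (i ↑ˡ m) c + h * A p c) (halves-↑ˡ n _ _ i) (partner-↑ˡ n i)

    B-lower : ∀ i c → B (n ↑ʳ i) c ≡ A (n ↑ʳ i) c + + 0
    B-lower i c = cong (λ h → A (n ↑ʳ i) c + h * A (partner n (n ↑ʳ i)) c) (halves-↑ʳ n _ _ i)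

    F-left : ∀ r j → F r (j ↑ˡ m) ≡ B r (j ↑ˡ m) + + 0
    F-left r j = cong (λ h → B r (j ↑ˡ m) + h * B r (partner n (j ↑ˡ m))) (halves-↑ˡ n _ _ j)

    F-right : ∀ r j → F r (n ↑ʳ j) ≡ B r (n ↑ʳ j) + -1ℤ * B r (cast j ↑ˡ m)
    F-right r j = cong₂ (λ h p → B r (n ↑ʳ j) + h * B r p) (halves-↑ʳ n _ _ j) (partner-↑ʳ n j)

    F-upper-upper : ∀ i j → F (i ↑ˡ m) (j ↑ˡ m) ≡ signedCyclic (+ 1) L (toℕ i) (toℕ j)
    F-upper-upper i j = begin
      F (i ↑ˡ m) (j ↑ˡ m)                                         ≡⟨ F-left (i ↑ˡ m) j ⟩
      B (i ↑ˡ m) (j ↑ˡ m) + + 0                                   ≡⟨ +-identityʳ _ ⟩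
      B (i ↑ˡ m) (j ↑ˡ m)                                         ≡⟨ B-upper i (j ↑ˡ m) ⟩
      A (i ↑ˡ m) (j ↑ˡ m) + + 1 * A (n ↑ʳ (i ↑ˡ 0)) (j ↑ˡ m)      ≡⟨ cong₂ (λ a b → a + + 1 * b) (upper-upper i j)
                                                                        (trans (lower-upper (i ↑ˡ 0) j) (cong (λ x → rung L x (toℕ j)) (toℕ-↑ˡ i 0))) ⟩
      signedCyclic (+ 1) L (toℕ i) (toℕ j)                        ∎

    F-upper-lower : ∀ i j → F (i ↑ˡ m) (n ↑ʳ j) ≡ + 0
    F-upper-lower i j = begin
      F (i ↑ˡ m) (n ↑ʳ j)                                                   ≡⟨ F-right (i ↑ˡ m) j ⟩
      B (i ↑ˡ m) (n ↑ʳ j) + -1ℤ * B (i ↑ˡ m) (cast j ↑ˡ m)                  ≡⟨ cong₂ (λ a b → a + -1ℤ * b) (B-upper i (n ↑ʳ j)) (B-upper i (cast j ↑ˡ m)) ⟩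
      (A (i ↑ˡ m) (n ↑ʳ j) + + 1 * A (n ↑ʳ (i ↑ˡ 0)) (n ↑ʳ j))
        + -1ℤ * (A (i ↑ˡ m) (cast j ↑ˡ m) + + 1 * A (n ↑ʳ (i ↑ˡ 0)) (cast j ↑ˡ m))
        ≡⟨ cong₂ (λ a b → a + -1ℤ * b)
                 (cong₂ (λ a b → a + + 1 * b) (upper-lower i j) (trans (lower-lower (i ↑ˡ 0) j) (cong (λ x → path x y) (toℕ-↑ˡ i 0))))
                 (cong₂ (λ a b → a + + 1 * b) (trans (upper-upper i (cast j)) (cong (path x) (toℕ-cast (ℕ.+-identityʳ n) j)))
                                              (trans (lower-upper (i ↑ˡ 0) (cast j)) (cong₂ (rung L) (toℕ-↑ˡ i 0) (toℕ-cast (ℕ.+-identityʳ n) j)))) ⟩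
      (rung L x y + + 1 * path x y) + -1ℤ * (path x y + + 1 * rung L x y)   ≡⟨ cancels (rung L x y) (path x y) ⟩
      + 0                                                                   ∎
      where
      x = toℕ i
      y = toℕ j
      cancels : ∀ r p → (r + + 1 * p) + -1ℤ * (p + + 1 * r) ≡ + 0
      cancels = solve-∀

    F-lower-lower : ∀ i j → F (n ↑ʳ i) (n ↑ʳ j) ≡ signedCyclic -1ℤ L (toℕ i) (toℕ j)
    F-lower-lower i j = begin
      F (n ↑ʳ i) (n ↑ʳ j)                                                ≡⟨ F-right (n ↑ʳ i) j ⟩
      B (n ↑ʳ i) (n ↑ʳ j) + -1ℤ * B (n ↑ʳ i) (cast j ↑ˡ m)               ≡⟨ cong₂ (λ a b → a + -1ℤ * b) (B-lower i (n ↑ʳ j)) (B-lower i (cast j ↑ˡ m)) ⟩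
      (A (n ↑ʳ i) (n ↑ʳ j) + + 0) + -1ℤ * (A (n ↑ʳ i) (cast j ↑ˡ m) + + 0) ≡⟨ cong₂ (λ a b → (a + + 0) + -1ℤ * (b + + 0)) (lower-lower i j)
                                                                                (trans (lower-upper i (cast j)) (cong (rung L (toℕ i)) (toℕ-cast (ℕ.+-identityʳ n) j))) ⟩
      (path x y + + 0) + -1ℤ * (rung L x y + + 0)                        ≡⟨ drop-zeros (path x y) (rung L x y) ⟩
      signedCyclic -1ℤ L x y                                             ∎
      where
      x = toℕ i
      y = toℕ j
      drop-zeros : ∀ p r → (p + + 0) + -1ℤ * (r + + 0) ≡ p + -1ℤ * r
      drop-zeros = solve-∀

  det-A-Mobius-halves : det (2 ℕ.* n) A ≡ det n (λ i j → signedCyclic (+ 1) L (toℕ i) (toℕ j))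
                                           * det m (λ i j → signedCyclic -1ℤ L (toℕ i) (toℕ j))
  det-A-Mobius-halves = begin
    det (n ℕ.+ m) A  ≡⟨ det-addRows {L ℕ.+ m} (halves n (+ 1) (+ 0)) (partner n) A (halves-source-fixed n (inj₂ refl)) ⟨
    det (n ℕ.+ m) B  ≡⟨ det-addColumns {L ℕ.+ m} (halves n (+ 0) -1ℤ) (partner n) B (halves-source-fixed n (inj₁ refl)) ⟨
    det (n ℕ.+ m) F  ≡⟨ det-block-lower-triangular n {m} F {λ i j → signedCyclic (+ 1) L (toℕ i) (toℕ j)}
                          {λ i j → signedCyclic -1ℤ L (toℕ i) (toℕ j)} F-upper-lower F-upper-upper F-lower-lower ⟩
    det n (λ i j → signedCyclic (+ 1) L (toℕ i) (toℕ j)) * det m (λ i j → signedCyclic -1ℤ L (toℕ i) (toℕ j)) ∎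

det-cast : ∀ {a b} → a ≡ b → (g : ℕ → ℕ → ℤ) → det a (λ i j → g (toℕ i) (toℕ j)) ≡ det b (λ i j → g (toℕ i) (toℕ j))
det-cast refl g = refl

sign-squared : ∀ t → sign t * sign t ≡ + 1
sign-squared zero    = refl
sign-squared (suc t) = trans (negate-both (sign t)) (sign-squared t)
  where
  negate-both : ∀ s → - s * - s ≡ s * s
  negate-both = solve-∀

-- det of the cyclic band of size 2 + t with diagonal s, off-diagonal 1 and corners s, up to the sign (−1)^t.
cyclicDet : ℤ → ℕ → ℤ
cyclicDet s t = det 2 (borderedBand s 1 (firstColumn (shiftⁿ s t (s , + 1)) s 1) (lastColumn s (shiftⁿ s t (s , + 0)) 1))

det-signedCyclic : ∀ s t → det (2 ℕ.+ t) (λ i j → signedCyclic s (suc t) (toℕ i) (toℕ j)) ≡ sign t * cyclicDet s t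
det-signedCyclic s t = trans (det-cong {2 ℕ.+ t} (λ i j → signedCyclic≡borderedEntry s t (toℕ i) (toℕ j)))
                             (det-borderedBand-iterate s s (s , + 1) (s , + 0) t)

det-A-Mobius : ∀ t → det (2 ℕ.* (2 ℕ.+ t)) (A-Mobius (2 ℕ.+ t)) ≡ cyclicDet (+ 1) t * cyclicDet -1ℤ t
det-A-Mobius t = begin
  det (2 ℕ.* n) (A-Mobius n)
    ≡⟨ det-A-Mobius-halves t ⟩
  det n (λ i j → signedCyclic (+ 1) (suc t) (toℕ i) (toℕ j)) * det (n ℕ.+ 0) (λ i j → signedCyclic -1ℤ (suc t) (toℕ i) (toℕ j))
    ≡⟨ cong (det n (λ i j → signedCyclic (+ 1) (suc t) (toℕ i) (toℕ j)) *_) (det-cast (ℕ.+-identityʳ n) (signedCyclic -1ℤ (suc t))) ⟩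
  det n (λ i j → signedCyclic (+ 1) (suc t) (toℕ i) (toℕ j)) * det n (λ i j → signedCyclic -1ℤ (suc t) (toℕ i) (toℕ j))
    ≡⟨ cong₂ _*_ (det-signedCyclic (+ 1) t) (det-signedCyclic -1ℤ t) ⟩
  (sign t * cyclicDet (+ 1) t) * (sign t * cyclicDet -1ℤ t)
    ≡⟨ regroup (sign t) (cyclicDet (+ 1) t) (cyclicDet -1ℤ t) ⟩
  (sign t * sign t) * (cyclicDet (+ 1) t * cyclicDet -1ℤ t)
    ≡⟨ cong (_* (cyclicDet (+ 1) t * cyclicDet -1ℤ t)) (sign-squared t) ⟩
  + 1 * (cyclicDet (+ 1) t * cyclicDet -1ℤ t)
    ≡⟨ *-identityˡ _ ⟩
  cyclicDet (+ 1) t * cyclicDet -1ℤ t ∎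
  where
  n = 2 ℕ.+ t
  regroup : ∀ s a b → (s * a) * (s * b) ≡ (s * s) * (a * b)
  regroup = solve-∀

MobiusClaim : ℕ → ℤ → Set
MobiusClaim r d = ((r ≡ 2 ⊎ r ≡ 4) → d ≡ -[1+ 2 ]) × ((r ≡ 1 ⊎ r ≡ 5) → d ≡ -[1+ 8 ]) × ((r ≡ 0 ⊎ r ≡ 3) → d ≡ + 0)

-- shift ±1 has order dividing 6, so the border parameters recur after six steps.
cyclicDet-periodic : ∀ s t → s ≡ + 1 ⊎ s ≡ -1ℤ → cyclicDet s (6 ℕ.+ t) ≡ cyclicDet s t
cyclicDet-periodic _ t (inj₁ refl) = refl
cyclicDet-periodic _ t (inj₂ refl) = refl

cyclicDet-product-claim : ∀ t → MobiusClaim ((2 ℕ.+ t) % 6) (cyclicDet (+ 1) t * cyclicDet -1ℤ t)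
cyclicDet-product-claim 0 = (λ _ → refl) , (λ { (inj₁ ()) ; (inj₂ ()) }) , (λ { (inj₁ ()) ; (inj₂ ()) })
cyclicDet-product-claim 1 = (λ { (inj₁ ()) ; (inj₂ ()) }) , (λ { (inj₁ ()) ; (inj₂ ()) }) , (λ _ → refl)
cyclicDet-product-claim 2 = (λ _ → refl) , (λ { (inj₁ ()) ; (inj₂ ()) }) , (λ { (inj₁ ()) ; (inj₂ ()) })
cyclicDet-product-claim 3 = (λ { (inj₁ ()) ; (inj₂ ()) }) , (λ _ → refl) , (λ { (inj₁ ()) ; (inj₂ ()) })
cyclicDet-product-claim 4 = (λ { (inj₁ ()) ; (inj₂ ()) }) , (λ { (inj₁ ()) ; (inj₂ ()) }) , (λ _ → refl)
cyclicDet-product-claim 5 = (λ { (inj₁ ()) ; (inj₂ ()) }) , (λ _ → refl) , (λ { (inj₁ ()) ; (inj₂ ()) })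
cyclicDet-product-claim (suc (suc (suc (suc (suc (suc t)))))) =
  subst₂ MobiusClaim (sym residue)
         (sym (cong₂ _*_ (cyclicDet-periodic (+ 1) t (inj₁ refl)) (cyclicDet-periodic -1ℤ t (inj₂ refl))))
         (cyclicDet-product-claim t)
  where
  residue : (2 ℕ.+ (6 ℕ.+ t)) % 6 ≡ (2 ℕ.+ t) % 6
  residue = trans (cong (_% 6) (ℕ.+-comm 6 (2 ℕ.+ t))) ([m+n]%n≡m%n (2 ℕ.+ t) 6)

theorem2 : (n : ℕ) → 1 < n →
    ((n % 6 ≡ 2 ⊎ n % 6 ≡ 4) → det (2 ℕ.* n) (A-Mobius n) ≡ -[1+ 2 ]) ×
    ((n % 6 ≡ 1 ⊎ n % 6 ≡ 5) → det (2 ℕ.* n) (A-Mobius n) ≡ -[1+ 8 ]) ×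
    ((n % 6 ≡ 0 ⊎ n % 6 ≡ 3) → det (2 ℕ.* n) (A-Mobius n) ≡ + 0)
theorem2 (suc zero)    (s≤s ())
theorem2 (suc (suc t)) _ = subst (MobiusClaim ((2 ℕ.+ t) % 6)) (sym (det-A-Mobius t)) (cyclicDet-product-claim t)
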